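{- The monoid $\langle\mathbf A\mid\mathbf R\rangle^+$ is right-cancellative.
   Context: Let $\mathbf A=\{a_\alpha\}$ be an alphabet indexed by all addresses $\alpha$ (finite words over $\{0,1\}$). Addresses $\alpha,\beta$ are orthogonal ($\alpha\perp\beta$) if there is an address $\gamma$ such that $\alpha$ begins with $\gamma0$ and $\beta$ with $\gamma1$, or vice versa. $\mathbf R$ is the family of relations, for all addresses $\alpha,\beta$: $a_\alpha a_\beta=a_\beta a_\alpha$ for $\alpha\perp\beta$; $a_{\alpha11\beta}a_\alpha=a_\alpha a_{\alpha1\beta}$; $a_{\alpha10\beta}a_\alpha=a_\alpha a_{\alpha01\beta}$; $a_{\alpha0\beta}a_\alpha=a_\alpha a_{\alpha00\beta}$; $a_\alpha^2=a_{\alpha1}a_\alpha a_{\alpha0}$. $\langle\mathbf A\mid\mathbf R\rangle^+$ is the monoid presented by generators $\mathbf A$ and relations $\mathbf R$. -}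

module Defs where

open import Data.Bool using (Bool; true; false)
open import Data.List using (List; []; _∷_; _++_; [_])
open import Data.Product using (∃-syntax; _×_)
open import Data.Sum using (_⊎_)
open import Relation.Binary.PropositionalEquality using (_≡_)

Address : Set
Address = List Bool

𝟘 𝟙 : Bool
𝟘 = false
𝟙 = true

Split : Address → Address → Set
Split α β = ∃[ γ ] ∃[ δ ] ∃[ ε ] (α ≡ γ ++ 𝟘 ∷ δ) × (β ≡ γ ++ 𝟙 ∷ ε)

_⊥ₐ_ : Address → Address → Set
α ⊥ₐ β = Split α β ⊎ Split β α

-- Words over the alphabet A = {a_α}: a word is a list of addresses
-- (the letter a_α is represented by α).
Word : Set
Word = List Address

data R : Word → Word → Set where
  rel-comm : ∀ {α β} → α ⊥ₐ β → R (α ∷ β ∷ []) (β ∷ α ∷ [])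
  rel-11   : ∀ α β → R ((α ++ 𝟙 ∷ 𝟙 ∷ β) ∷ α ∷ []) (α ∷ (α ++ 𝟙 ∷ β) ∷ [])
  rel-10   : ∀ α β → R ((α ++ 𝟙 ∷ 𝟘 ∷ β) ∷ α ∷ []) (α ∷ (α ++ 𝟘 ∷ 𝟙 ∷ β) ∷ [])
  rel-0    : ∀ α β → R ((α ++ 𝟘 ∷ β) ∷ α ∷ []) (α ∷ (α ++ 𝟘 ∷ 𝟘 ∷ β) ∷ [])
  rel-sq   : ∀ α → R (α ∷ α ∷ []) ((α ++ [ 𝟙 ]) ∷ α ∷ (α ++ [ 𝟘 ]) ∷ [])

-- The congruence on Word generated by R; the monoid ⟨A | R⟩⁺ is Word / _≈R_.
infix 4 _≈R_
data _≈R_ : Word → Word → Set where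
  ≈-step  : ∀ u v {l r} → R l r → (u ++ l ++ v) ≈R (u ++ r ++ v)
  ≈-refl  : ∀ {u} → u ≈R u
  ≈-sym   : ∀ {u v} → u ≈R v → v ≈R u
  ≈-trans : ∀ {u v w} → u ≈R v → v ≈R w → u ≈R w

RightCancellative : Set
RightCancellative = ∀ (u v w : Word) → (u ++ w) ≈R (v ++ w) → u ≈R v

module Submission where

-- The proof is semantic.  The monoid acts partially on finite binary trees:
-- the letter a_α performs the rotation A(BC) ↦ (AB)C on the subtree at
-- address α.  Every relation of R holds in this action, so equivalent words
-- act identically.  A tree t is encoded by its bracket vector `code t`: for
-- each internal node, in infix order, the size of its right subtree.  A
-- rotation lowers exactly one entry of the code.  Three facts drive the proof:
--   * reachability: if code t ≤ code r pointwise, some word takes r to t;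
--   * joins: two different rotations α, β of one tree are completed by words
--     c, d to a common tree whose code is pointwise one of theirs, with
--     α c ≈ β d in the monoid (this is where the relations are used);
--   * each word acts injectively.
-- Joins and reachability give, by well-founded induction on the sum of the
-- code, that two words taking a tree s to the same tree t are equivalent
-- (`coherence`).  If uw ≈ vw, choose a tree so full that uw acts on it;
-- by injectivity of w, u and v have the same result there, hence u ≈ v.

open import Defs
open import Data.Bool as Bool using (true; false)
open import Data.Empty using (⊥; ⊥-elim)
open import Data.List using (List; []; _∷_; _++_; [_]; map; length)
open import Data.List.Properties using (++-assoc; ++-identityʳ; map-++; length-++; ∷-injective; ++-conicalʳ; ≡-dec)
open import Data.List.Relation.Binary.Pointwise as Pointwise using (Pointwise; []; _∷_)
open import Data.Maybe using (Maybe; just; nothing; _>>=_)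
import Data.Maybe as Maybe
open import Data.Nat using (ℕ; zero; suc; _+_; _≤_; _<_; z≤n; s≤s; _≟_; _≤?_; pred)
open import Data.Nat.Induction using (<-wellFounded)
open import Data.Nat.ListAction using (sum)
open import Data.Nat.Properties
  using (≤-refl; ≤-trans; ≤-reflexive; ≤-antisym; <⇒≤; ≤-<-trans; <-irrefl; <-cmp; ≰⇒>; n≤0⇒n≡0;
         +-assoc; +-comm; +-suc; +-identityʳ; +-mono-≤; +-mono-<-≤; +-mono-≤-<; +-monoʳ-<;
         m<m+n; m≤m+n; n<1+n; module ≤-Reasoning)
open import Data.Product using (∃-syntax; _×_; _,_; proj₂)
open import Data.Sum using (inj₁; inj₂)
open import Data.Unit using (⊤; tt)
open import Function using (_∘_)
open import Induction.WellFounded using (Acc; acc)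
open import Relation.Binary.Definitions using (tri<; tri≈; tri>)
open import Relation.Binary.PropositionalEquality hiding ([_])
open import Relation.Nullary using (yes; no)

data Tree : Set where
  leaf : Tree
  node : Tree → Tree → Tree

rotate : Tree → Maybe Tree
rotate (node A (node B C)) = just (node (node A B) C)
rotate _                   = nothing

at : Address → (Tree → Maybe Tree) → Tree → Maybe Tree
at []          f t          = f t
at (_ ∷ _)     f leaf       = nothing
at (false ∷ γ) f (node A B) = Maybe.map (λ A′ → node A′ B) (at γ f A)
at (true ∷ γ)  f (node A B) = Maybe.map (node A) (at γ f B)

rot : Address → Tree → Maybe Tree
rot α = at α rotate

act : Word → Tree → Maybe Tree
act []      t = just t
act (α ∷ w) t = rot α t >>= act w

>>=-cong : ∀ m {f g : Tree → Maybe Tree} → (∀ x → f x ≡ g x) → (m >>= f) ≡ (m >>= g)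
>>=-cong (just x) f≗g = f≗g x
>>=-cong nothing  f≗g = refl

>>=-assoc : ∀ m (f g : Tree → Maybe Tree) → (m >>= f >>= g) ≡ (m >>= λ x → f x >>= g)
>>=-assoc (just x) f g = refl
>>=-assoc nothing  f g = refl

>>=-just : ∀ (m : Maybe Tree) → (m >>= just) ≡ m
>>=-just (just x) = refl
>>=-just nothing  = refl

>>=-inv : ∀ m (f : Tree → Maybe Tree) {t} → (m >>= f) ≡ just t → ∃[ x ] (m ≡ just x × f x ≡ just t)
>>=-inv (just x) f e = x , refl , e

map-inv : ∀ (f : Tree → Tree) m {t} → Maybe.map f m ≡ just t → ∃[ x ] (m ≡ just x × t ≡ f x)
map-inv f (just x) refl = x , refl , refl

rot-left : ∀ α A B {A′} → rot α A ≡ just A′ → rot (𝟘 ∷ α) (node A B) ≡ just (node A′ B)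
rot-left α A B e = cong (Maybe.map _) e

rot-right : ∀ α A B {B′} → rot α B ≡ just B′ → rot (𝟙 ∷ α) (node A B) ≡ just (node A B′)
rot-right α A B e = cong (Maybe.map _) e

at-cong : ∀ γ {f g} → (∀ x → f x ≡ g x) → ∀ t → at γ f t ≡ at γ g t
at-cong []          f≗g t          = f≗g t
at-cong (_ ∷ _)     f≗g leaf       = refl
at-cong (false ∷ γ) f≗g (node A B) = cong (Maybe.map _) (at-cong γ f≗g A)
at-cong (true ∷ γ)  f≗g (node A B) = cong (Maybe.map _) (at-cong γ f≗g B)

at-++ : ∀ γ δ f t → at (γ ++ δ) f t ≡ at γ (at δ f) t
at-++ []          δ f t          = refl
at-++ (_ ∷ _)     δ f leaf       = refl
at-++ (false ∷ γ) δ f (node A B) = cong (Maybe.map _) (at-++ γ δ f A)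
at-++ (true ∷ γ)  δ f (node A B) = cong (Maybe.map _) (at-++ γ δ f B)

at->>= : ∀ γ f g t → (at γ f t >>= at γ g) ≡ at γ (λ x → f x >>= g) t
at->>= []          f g t          = refl
at->>= (_ ∷ _)     f g leaf       = refl
at->>= (false ∷ γ) f g (node A B) with at γ f A | at->>= γ f g A
... | just _  | eq = cong (Maybe.map _) eq
... | nothing | eq = cong (Maybe.map _) eq
at->>= (true ∷ γ)  f g (node A B) with at γ f B | at->>= γ f g B
... | just _  | eq = cong (Maybe.map _) eq
... | nothing | eq = cong (Maybe.map _) eq

act-++ : ∀ u v t → act (u ++ v) t ≡ (act u t >>= act v)
act-++ []      v t = refl
act-++ (α ∷ u) v t = begin
  (rot α t >>= act (u ++ v))             ≡⟨ >>=-cong (rot α t) (act-++ u v) ⟩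
  (rot α t >>= λ x → act u x >>= act v)  ≡⟨ >>=-assoc (rot α t) (act u) (act v) ⟨
  (rot α t >>= act u >>= act v)          ∎
  where open ≡-Reasoning

act-++-inv : ∀ u w s {y} → act (u ++ w) s ≡ just y → ∃[ x ] (act u s ≡ just x × act w x ≡ just y)
act-++-inv u w s e = >>=-inv (act u s) (act w) (trans (sym (act-++ u w s)) e)

act-then : ∀ c e s {r t} → act c s ≡ just r → act e r ≡ just t → act (c ++ e) s ≡ just t
act-then c e s ec ee = trans (act-++ c e s) (trans (cong (_>>= act e) ec) ee)

act-shift : ∀ γ α w t → act (map (γ ++_) (α ∷ w)) t ≡ at γ (act (α ∷ w)) t
act-shift γ α [] t = begin
  (rot (γ ++ α) t >>= just)  ≡⟨ >>=-just _ ⟩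
  rot (γ ++ α) t             ≡⟨ at-++ γ α rotate t ⟩
  at γ (rot α) t             ≡⟨ at-cong γ (λ x → >>=-just (rot α x)) t ⟨
  at γ (act (α ∷ [])) t      ∎
  where open ≡-Reasoning
act-shift γ α (β ∷ w) t = begin
  (rot (γ ++ α) t >>= act (map (γ ++_) (β ∷ w)))  ≡⟨ >>=-cong (rot (γ ++ α) t) (act-shift γ β w) ⟩
  (rot (γ ++ α) t >>= at γ (act (β ∷ w)))         ≡⟨ cong (_>>= at γ (act (β ∷ w))) (at-++ γ α rotate t) ⟩
  (at γ (rot α) t >>= at γ (act (β ∷ w)))         ≡⟨ at->>= γ (rot α) (act (β ∷ w)) t ⟩
  at γ (act (α ∷ β ∷ w)) t                        ∎
  where open ≡-Reasoning

act-left : ∀ c A B → act (map (𝟘 ∷_) c) (node A B) ≡ Maybe.map (λ X → node X B) (act c A)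
act-left []      A B = refl
act-left (α ∷ c) A B = act-shift [ 𝟘 ] α c (node A B)

act-right : ∀ c A B → act (map (𝟙 ∷_) c) (node A B) ≡ Maybe.map (node A) (act c B)
act-right []      A B = refl
act-right (α ∷ c) A B = act-shift [ 𝟙 ] α c (node A B)

infix 4 _≐_
_≐_ : Word → Word → Set
u ≐ v = ∀ t → act u t ≡ act v t

≐-shift : ∀ γ α u β v → (α ∷ u) ≐ (β ∷ v) → map (γ ++_) (α ∷ u) ≐ map (γ ++_) (β ∷ v)
≐-shift γ α u β v eq t = begin
  act (map (γ ++_) (α ∷ u)) t  ≡⟨ act-shift γ α u t ⟩
  at γ (act (α ∷ u)) t         ≡⟨ at-cong γ eq t ⟩
  at γ (act (β ∷ v)) t         ≡⟨ act-shift γ β v t ⟨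
  act (map (γ ++_) (β ∷ v)) t  ∎
  where open ≡-Reasoning

root-comm : ∀ δ ε → ((𝟘 ∷ δ) ∷ (𝟙 ∷ ε) ∷ []) ≐ ((𝟙 ∷ ε) ∷ (𝟘 ∷ δ) ∷ [])
root-comm δ ε leaf = refl
root-comm δ ε (node A B) with rot δ A in eA | rot ε B in eB
... | just _  | just _  rewrite eA | eB = refl
... | just _  | nothing rewrite eB      = refl
... | nothing | just _  rewrite eA      = refl
... | nothing | nothing                 = refl

root-11 : ∀ β → ((𝟙 ∷ 𝟙 ∷ β) ∷ [] ∷ []) ≐ ([] ∷ (𝟙 ∷ β) ∷ [])
root-11 β leaf          = refl
root-11 β (node A leaf) = refl
root-11 β (node A (node B C)) with rot β C
... | just _  = refl
... | nothing = refl

root-10 : ∀ β → ((𝟙 ∷ 𝟘 ∷ β) ∷ [] ∷ []) ≐ ([] ∷ (𝟘 ∷ 𝟙 ∷ β) ∷ [])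
root-10 β leaf          = refl
root-10 β (node A leaf) = refl
root-10 β (node A (node B C)) with rot β B
... | just _  = refl
... | nothing = refl

root-0 : ∀ β → ((𝟘 ∷ β) ∷ [] ∷ []) ≐ ([] ∷ (𝟘 ∷ 𝟘 ∷ β) ∷ [])
root-0 β leaf = refl
root-0 β (node A leaf) with rot β A
... | just _  = refl
... | nothing = refl
root-0 β (node A (node B C)) with rot β A
... | just _  = refl
... | nothing = refl

root-sq : ([] ∷ [] ∷ []) ≐ ((𝟙 ∷ []) ∷ [] ∷ (𝟘 ∷ []) ∷ [])
root-sq leaf                         = refl
root-sq (node A leaf)                = refl
root-sq (node A (node B leaf))       = refl
root-sq (node A (node B (node C D))) = refl

-- Soundness: every relation of R, being a shift of a root relation, holds in
-- the action, and hence so does the congruence it generates.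
R-sound : ∀ {l r} → R l r → l ≐ r
R-sound (rel-comm (inj₁ (γ , δ , ε , refl , refl))) =
  ≐-shift γ (𝟘 ∷ δ) [ 𝟙 ∷ ε ] (𝟙 ∷ ε) [ 𝟘 ∷ δ ] (root-comm δ ε)
R-sound (rel-comm (inj₂ (γ , δ , ε , refl , refl))) =
  ≐-shift γ (𝟙 ∷ ε) [ 𝟘 ∷ δ ] (𝟘 ∷ δ) [ 𝟙 ∷ ε ] (λ t → sym (root-comm δ ε t))
R-sound (rel-11 α β) = subst (λ a → ((α ++ 𝟙 ∷ 𝟙 ∷ β) ∷ a ∷ []) ≐ (a ∷ (α ++ 𝟙 ∷ β) ∷ []))
                             (++-identityʳ α) (≐-shift α (𝟙 ∷ 𝟙 ∷ β) [ [] ] [] [ 𝟙 ∷ β ] (root-11 β))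
R-sound (rel-10 α β) = subst (λ a → ((α ++ 𝟙 ∷ 𝟘 ∷ β) ∷ a ∷ []) ≐ (a ∷ (α ++ 𝟘 ∷ 𝟙 ∷ β) ∷ []))
                             (++-identityʳ α) (≐-shift α (𝟙 ∷ 𝟘 ∷ β) [ [] ] [] [ 𝟘 ∷ 𝟙 ∷ β ] (root-10 β))
R-sound (rel-0 α β)  = subst (λ a → ((α ++ 𝟘 ∷ β) ∷ a ∷ []) ≐ (a ∷ (α ++ 𝟘 ∷ 𝟘 ∷ β) ∷ []))
                             (++-identityʳ α) (≐-shift α (𝟘 ∷ β) [ [] ] [] [ 𝟘 ∷ 𝟘 ∷ β ] (root-0 β))
R-sound (rel-sq α)   = subst (λ a → (a ∷ a ∷ []) ≐ ((α ++ [ 𝟙 ]) ∷ a ∷ (α ++ [ 𝟘 ]) ∷ []))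
                             (++-identityʳ α) (≐-shift α [] [ [] ] [ 𝟙 ] ([] ∷ [ 𝟘 ] ∷ []) root-sq)

≈-sound : ∀ {u v} → u ≈R v → u ≐ v
≈-sound (≈-step u v {l} {r} l~r) t = begin
  act (u ++ l ++ v) t         ≡⟨ act-++ u (l ++ v) t ⟩
  (act u t >>= act (l ++ v))  ≡⟨ >>=-cong (act u t) middle ⟩
  (act u t >>= act (r ++ v))  ≡⟨ act-++ u (r ++ v) t ⟨
  act (u ++ r ++ v) t         ∎
  where
  open ≡-Reasoning
  middle : ∀ x → act (l ++ v) x ≡ act (r ++ v) x
  middle x = begin
    act (l ++ v) x       ≡⟨ act-++ l v x ⟩
    (act l x >>= act v)  ≡⟨ cong (_>>= act v) (R-sound l~r x) ⟩
    (act r x >>= act v)  ≡⟨ act-++ r v x ⟨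
    act (r ++ v) x       ∎
≈-sound ≈-refl        t = refl
≈-sound (≈-sym p)     t = sym (≈-sound p t)
≈-sound (≈-trans p q) t = trans (≈-sound p t) (≈-sound q t)

≈-cons : ∀ α {u v} → u ≈R v → (α ∷ u) ≈R (α ∷ v)
≈-cons α (≈-step u v l~r) = ≈-step (α ∷ u) v l~r
≈-cons α ≈-refl          = ≈-refl
≈-cons α (≈-sym p)       = ≈-sym (≈-cons α p)
≈-cons α (≈-trans p q)   = ≈-trans (≈-cons α p) (≈-cons α q)

≈-app : ∀ e {u v} → u ≈R v → (u ++ e) ≈R (v ++ e)
≈-app e (≈-step u v {l} {r} l~r) = subst₂ _≈R_ (reassoc l) (reassoc r) (≈-step u (v ++ e) l~r)
  where
  reassoc : ∀ m → u ++ m ++ (v ++ e) ≡ (u ++ m ++ v) ++ e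
  reassoc m = sym (trans (++-assoc u (m ++ v) e) (cong (u ++_) (++-assoc m v e)))
≈-app e ≈-refl        = ≈-refl
≈-app e (≈-sym p)     = ≈-sym (≈-app e p)
≈-app e (≈-trans p q) = ≈-trans (≈-app e p) (≈-app e q)

R-shift : ∀ b {l r} → R l r → R (map (b ∷_) l) (map (b ∷_) r)
R-shift b (rel-comm (inj₁ (γ , δ , ε , refl , refl))) = rel-comm (inj₁ (b ∷ γ , δ , ε , refl , refl))
R-shift b (rel-comm (inj₂ (γ , δ , ε , refl , refl))) = rel-comm (inj₂ (b ∷ γ , δ , ε , refl , refl))
R-shift b (rel-11 α β) = rel-11 (b ∷ α) β
R-shift b (rel-10 α β) = rel-10 (b ∷ α) β
R-shift b (rel-0 α β)  = rel-0 (b ∷ α) β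
R-shift b (rel-sq α)   = rel-sq (b ∷ α)

≈-shift : ∀ b {u v} → u ≈R v → map (b ∷_) u ≈R map (b ∷_) v
≈-shift b (≈-step u v {l} {r} l~r) =
  subst₂ _≈R_ (sym (map-++₃ l)) (sym (map-++₃ r)) (≈-step (map (b ∷_) u) (map (b ∷_) v) (R-shift b l~r))
  where
  map-++₃ : ∀ m → map (b ∷_) (u ++ m ++ v) ≡ map (b ∷_) u ++ map (b ∷_) m ++ map (b ∷_) v
  map-++₃ m = trans (map-++ (b ∷_) u (m ++ v)) (cong (map (b ∷_) u ++_) (map-++ (b ∷_) m v))
≈-shift b ≈-refl        = ≈-refl
≈-shift b (≈-sym p)     = ≈-sym (≈-shift b p)
≈-shift b (≈-trans p q) = ≈-trans (≈-shift b p) (≈-shift b q)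

rot-injective : ∀ α s s′ {x} → rot α s ≡ just x → rot α s′ ≡ just x → s ≡ s′
rot-injective [] (node A (node B C)) (node A′ (node B′ C′)) refl refl = refl
rot-injective (false ∷ α) (node A B) (node A′ B′) e e′
  with map-inv _ (rot α A) e | map-inv _ (rot α A′) e′
... | A₁ , eA , refl | A₁′ , eA′ , refl = cong (λ X → node X B) (rot-injective α A A′ eA eA′)
rot-injective (true ∷ α) (node A B) (node A′ B′) e e′
  with map-inv _ (rot α B) e | map-inv _ (rot α B′) e′
... | B₁ , eB , refl | B₁′ , eB′ , refl = cong (node A) (rot-injective α B B′ eB eB′)

act-injective : ∀ w s s′ {x} → act w s ≡ just x → act w s′ ≡ just x → s ≡ s′
act-injective []      s s′ refl refl = refl
act-injective (α ∷ w) s s′ e e′ with >>=-inv (rot α s) (act w) e | >>=-inv (rot α s′) (act w) e′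
... | s₁ , e₁ , e₂ | s₁′ , e₁′ , e₂′ with act-injective w s₁ s₁′ e₂ e₂′
... | refl = rot-injective α s s′ e₁ e₁′

-- Deep d t: every leaf of t lies at depth at least d.  A word acts on every
-- tree that is deep enough, e.g. on a large complete tree.
Deep : ℕ → Tree → Set
Deep zero    t          = ⊤
Deep (suc d) leaf       = ⊥
Deep (suc d) (node A B) = Deep d A × Deep d B

Deep-down : ∀ {d} t → Deep (suc d) t → Deep d t
Deep-down {zero}  t          _        = tt
Deep-down {suc d} (node A B) (dA , dB) = Deep-down A dA , Deep-down B dB

Deep-weaken : ∀ k {d t} → Deep (k + d) t → Deep d t
Deep-weaken zero    deep = deep
Deep-weaken (suc k) deep = Deep-weaken k (Deep-down _ deep)

deep-node : ∀ {d A B} → Deep d A → Deep d B → Deep d (node A B)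
deep-node {zero}  _  _  = tt
deep-node {suc d} dA dB = Deep-down _ dA , Deep-down _ dB

full : ℕ → Tree
full zero    = leaf
full (suc d) = node (full d) (full d)

Deep-full : ∀ d → Deep d (full d)
Deep-full zero    = tt
Deep-full (suc d) = Deep-full d , Deep-full d

-- A rotation at α only changes the top length α + 2 levels of the tree.
rot-deep : ∀ α d t → Deep (suc (suc (length α + d))) t → ∃[ t′ ] (rot α t ≡ just t′ × Deep d t′)
rot-deep [] d (node A (node B C)) (dA , dB , dC) =
  node (node A B) C , refl , deep-node (deep-node (Deep-down A dA) dB) dC
rot-deep (false ∷ α) d (node A B) (dA , dB) with rot-deep α d A dA
... | A′ , eA , dA′ = node A′ B , rot-left α A B eA , deep-node dA′ (Deep-weaken (2 + length α) dB)
rot-deep (true ∷ α) d (node A B) (dA , dB) with rot-deep α d B dB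
... | B′ , eB , dB′ = node A B′ , rot-right α A B eB , deep-node (Deep-weaken (2 + length α) dA) dB′

cost : Word → ℕ
cost []      = 0
cost (α ∷ w) = suc (suc (length α + cost w))

act-deep : ∀ w t → Deep (cost w) t → ∃[ t′ ] act w t ≡ just t′
act-deep []      t _    = t , refl
act-deep (α ∷ w) t deep with rot-deep α (cost w) t deep
... | t₁ , e , deep₁ rewrite e = act-deep w t₁ deep₁

size : Tree → ℕ
size leaf       = 0
size (node A B) = size A + suc (size B)

code : Tree → List ℕ
code leaf       = []
code (node A B) = code A ++ size B ∷ code B

length-code : ∀ t → length (code t) ≡ size t
length-code leaf       = refl
length-code (node A B) =
  trans (length-++ (code A)) (cong₂ (λ a b → a + suc b) (length-code A) (length-code B))

code-length : ∀ s t → size s ≡ size t → length (code s) ≡ length (code t)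
code-length s t e = trans (length-code s) (trans e (sym (length-code t)))

code-assocˡ : ∀ A B C → code (node (node A B) C) ≡ code A ++ size B ∷ code B ++ size C ∷ code C
code-assocˡ A B C = ++-assoc (code A) (size B ∷ code B) (size C ∷ code C)

infix 4 _≤*_ _<*_
_≤*_ : List ℕ → List ℕ → Set
_≤*_ = Pointwise _≤_

data _<*_ : List ℕ → List ℕ → Set where
  here  : ∀ {x y u v} → x < y → u ≤* v → (x ∷ u) <* (y ∷ v)
  there : ∀ {x y u v} → x ≤ y → u <* v → (x ∷ u) <* (y ∷ v)

≤*-refl : ∀ {u} → u ≤* u
≤*-refl = Pointwise.refl ≤-refl

≤*-trans : ∀ {u v w} → u ≤* v → v ≤* w → u ≤* w
≤*-trans = Pointwise.transitive ≤-trans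

<*⇒≤* : ∀ {u v} → u <* v → u ≤* v
<*⇒≤* (here x<y u≤v)  = <⇒≤ x<y ∷ u≤v
<*⇒≤* (there x≤y u<v) = x≤y ∷ <*⇒≤* u<v

_++≤_ : ∀ {u u′ v v′} → u ≤* u′ → v ≤* v′ → (u ++ v) ≤* (u′ ++ v′)
_++≤_ = Pointwise.++⁺

_++<_ : ∀ {u u′ v v′} → u ≤* u′ → v <* v′ → (u ++ v) <* (u′ ++ v′)
[]        ++< v<v′ = v<v′
(x≤ ∷ u≤) ++< v<v′ = there x≤ (u≤ ++< v<v′)

_<++_ : ∀ {u u′ v v′} → u <* u′ → v ≤* v′ → (u ++ v) <* (u′ ++ v′)
here x< u≤  <++ v≤ = here x< (u≤ ++≤ v≤)
there x≤ u< <++ v≤ = there x≤ (u< <++ v≤)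

sum-≤ : ∀ {u v} → u ≤* v → sum u ≤ sum v
sum-≤ = Pointwise.foldr⁺ +-mono-≤ ≤-refl

sum-< : ∀ {u v} → u <* v → sum u < sum v
sum-< (here x< u≤)  = +-mono-<-≤ x< (sum-≤ u≤)
sum-< (there x≤ u<) = +-mono-≤-< x≤ (sum-< u<)

split-at : ∀ u {y v w} → w ≤* (u ++ y ∷ v) →
           ∃[ w₁ ] ∃[ x ] ∃[ w₂ ] (w ≡ w₁ ++ x ∷ w₂ × w₁ ≤* u × x ≤ y × w₂ ≤* v)
split-at []      (x≤y ∷ w≤v)   = [] , _ , _ , refl , [] , x≤y , w≤v
split-at (z ∷ u) (x≤z ∷ w≤uyv) with split-at u w≤uyv
... | w₁ , x , w₂ , refl , w₁≤u , x≤y , w₂≤v = _ ∷ w₁ , x , w₂ , refl , x≤z ∷ w₁≤u , x≤y , w₂≤v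

-- Rotations preserve the size and strictly decrease the code: at the root,
-- A(BC) ↦ (AB)C lowers the entry of the root node from |B| + 1 + |C| to |B|.
rot-size : ∀ α s {s′} → rot α s ≡ just s′ → size s′ ≡ size s
rot-size [] (node A (node B C)) refl = +-assoc (size A) (suc (size B)) (suc (size C))
rot-size (false ∷ α) (node A B) e with map-inv _ (rot α A) e
... | A′ , eA , refl = cong (λ n → n + suc (size B)) (rot-size α A eA)
rot-size (true ∷ α) (node A B) e with map-inv _ (rot α B) e
... | B′ , eB , refl = cong (λ n → size A + suc n) (rot-size α B eB)

rot-decreasing : ∀ α s {s′} → rot α s ≡ just s′ → code s′ <* code s
rot-decreasing [] (node A (node B C)) refl rewrite code-assocˡ A B C =
  ≤*-refl {code A} ++< here (m<m+n (size B) (s≤s z≤n)) ≤*-refl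
rot-decreasing (false ∷ α) (node A B) e with map-inv _ (rot α A) e
... | A′ , eA , refl = rot-decreasing α A eA <++ ≤*-refl
rot-decreasing (true ∷ α) (node A B) e with map-inv _ (rot α B) e
... | B′ , eB , refl = ≤*-refl {code A} ++< there (≤-reflexive (rot-size α B eB)) (rot-decreasing α B eB)

act-size : ∀ w s {t} → act w s ≡ just t → size t ≡ size s
act-size []      s refl = refl
act-size (α ∷ w) s e with >>=-inv (rot α s) (act w) e
... | s₁ , e₁ , e₂ = trans (act-size w s₁ e₂) (rot-size α s e₁)

act-decreasing : ∀ w s {t} → act w s ≡ just t → code t ≤* code s
act-decreasing []      s refl = ≤*-refl
act-decreasing (α ∷ w) s e with >>=-inv (rot α s) (act w) e
... | s₁ , e₁ , e₂ = ≤*-trans (act-decreasing w s₁ e₂) (<*⇒≤* (rot-decreasing α s e₁))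

act-strict : ∀ α w s {t} → act (α ∷ w) s ≡ just t → sum (code t) < sum (code s)
act-strict α w s e with >>=-inv (rot α s) (act w) e
... | s₁ , e₁ , e₂ = ≤-<-trans (sum-≤ (act-decreasing w s₁ e₂)) (sum-< (rot-decreasing α s e₁))

-- Bounded e w: the entry of w at position i < e satisfies w_i + i < e.
-- The code of a tree is bounded by its size.
Bounded : ℕ → List ℕ → Set
Bounded zero    w       = ⊤
Bounded (suc e) []      = ⊤
Bounded (suc e) (y ∷ w) = y ≤ e × Bounded e w

bounded-prefix : ∀ e u v → Bounded e (u ++ v) → Bounded e u
bounded-prefix zero    u       v _         = tt
bounded-prefix (suc e) []      v _         = tt
bounded-prefix (suc e) (y ∷ u) v (y≤ , bd) = y≤ , bounded-prefix e u v bd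

bounded-extend : ∀ e u v → Bounded e u → e ≤ length u → Bounded e (u ++ v)
bounded-extend zero    u       v _         _        = tt
bounded-extend (suc e) (y ∷ u) v (y≤ , bd) (s≤s e≤) = y≤ , bounded-extend e u v bd e≤

bounded-++ : ∀ u e v → Bounded (length u) u → Bounded e v → Bounded (length u + e) (u ++ v)
bounded-++ []      e v _         bv = bv
bounded-++ (x ∷ u) e v (x≤ , bu) bv = ≤-trans x≤ (m≤m+n _ e) , bounded-++ u e v bu bv

bounded-at : ∀ e u y v → Bounded e (u ++ y ∷ v) → length u < e → y + length u < e
bounded-at (suc e) []      y v (y≤ , _) _         rewrite +-identityʳ y = s≤s y≤
bounded-at (suc e) (z ∷ u) y v (_ , bd) (s≤s u<e) rewrite +-suc y (length u) = s≤s (bounded-at e u y v bd u<e)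

code-bounded : ∀ t → Bounded (length (code t)) (code t)
code-bounded leaf       = tt
code-bounded (node A B) rewrite length-++ (code A) {size B ∷ code B} | length-code B =
  bounded-++ (code A) (suc (size B)) (size B ∷ code B) (code-bounded A)
    (≤-refl , subst (λ n → Bounded n (code B)) (length-code B) (code-bounded B))

bounded-code-node : ∀ B₁ B₂ x → Bounded x (code (node B₁ B₂)) → size B₁ < x → size (node B₁ B₂) ≤ x
bounded-code-node B₁ B₂ x bd B₁<x = begin
  size B₁ + suc (size B₂)  ≡⟨ trans (+-suc (size B₁) (size B₂)) (cong suc (+-comm (size B₁) (size B₂))) ⟩
  suc (size B₂ + size B₁)  ≤⟨ subst (λ n → size B₂ + n < x) (length-code B₁)
                                (bounded-at x (code B₁) (size B₂) (code B₂) bd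
                                  (subst (_< x) (sym (length-code B₁)) B₁<x)) ⟩
  x                        ∎
  where open ≤-Reasoning

-- Nested w: each entry x of w bounds the list that follows it.  Codes of
-- trees are nested; this is the invariant that makes one-step descent work.
Nested : List ℕ → Set
Nested []      = ⊤
Nested (x ∷ w) = Bounded x w × Nested w

nested-prefix : ∀ u v → Nested (u ++ v) → Nested u
nested-prefix []      v _         = tt
nested-prefix (x ∷ u) v (bx , nu) = bounded-prefix x u v bx , nested-prefix u v nu

nested-suffix : ∀ u v → Nested (u ++ v) → Nested v
nested-suffix []      v nv       = nv
nested-suffix (x ∷ u) v (_ , nu) = nested-suffix u v nu

nested-++ : ∀ u v → Nested u → Bounded (length u) u → Nested v → Nested (u ++ v)
nested-++ []      v _         _         nv = nv
nested-++ (x ∷ u) v (bx , nu) (x≤ , bu) nv = bounded-extend x u v bx x≤ , nested-++ u v nu bu nv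

code-nested : ∀ t → Nested (code t)
code-nested leaf       = tt
code-nested (node A B) = nested-++ (code A) (size B ∷ code B) (code-nested A) (code-bounded A)
  (subst (λ n → Bounded n (code B)) (length-code B) (code-bounded B) , code-nested B)

-- The code determines the tree: the root sits at the first position i of
-- the code with w_i + i = size − 1, because the entries of the left
-- subtree satisfy w_i + i < size of the left subtree.
++-cancel-length : ∀ (u u′ : List ℕ) {v v′} → length u ≡ length u′ → u ++ v ≡ u′ ++ v′ → u ≡ u′ × v ≡ v′
++-cancel-length []      []        _   e = refl , e
++-cancel-length (x ∷ u) (x′ ∷ u′) len e with ∷-injective e
... | refl , e′ with ++-cancel-length u u′ (cong pred len) e′
... | refl , e″ = refl , e″

prefix-extends : ∀ u (x : ℕ) v u′ v′ → u ++ x ∷ v ≡ u′ ++ v′ → length u < length u′ → ∃[ m ] u′ ≡ u ++ x ∷ m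
prefix-extends []      x v (y ∷ u′) v′ refl _ = u′ , refl
prefix-extends (z ∷ u) x v (y ∷ u′) v′ e (s≤s u<u′) with ∷-injective e
... | refl , e′ with prefix-extends u x v u′ v′ e′ u<u′
... | m , refl = m , refl

root-determined : ∀ A B C D → size A < size C → code (node A B) ≢ code (node C D)
root-determined A B C D sA<sC e
  with prefix-extends (code A) (size B) (code B) (code C) _ e (subst₂ _<_ (sym (length-code A)) (sym (length-code C)) sA<sC)
... | m , eC = <-irrefl refl (begin-strict
  size C                 ≤⟨ m≤m+n (size C) (size D) ⟩
  size C + size D        <⟨ +-monoʳ-< (size C) (n<1+n (size D)) ⟩
  size C + suc (size D)  ≡⟨ trans (sym (length-code (node A B))) (trans (cong length e) (length-code (node C D))) ⟨
  size A + suc (size B)  ≡⟨ trans (+-suc (size A) (size B)) (cong suc (+-comm (size A) (size B))) ⟩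
  suc (size B + size A)  ≤⟨ B-fits ⟩
  size C                 ∎)
  where
  open ≤-Reasoning
  B-fits : size B + size A < size C
  B-fits = subst (λ n → size B + n < size C) (length-code A)
    (bounded-at (size C) (code A) (size B) m (subst₂ Bounded (length-code C) eC (code-bounded C))
      (subst (_< size C) (sym (length-code A)) sA<sC))

code-injective : ∀ s t → code s ≡ code t → s ≡ t
code-injective leaf       leaf       _ = refl
code-injective leaf       (node C D) e with ++-conicalʳ (code C) _ (sym e)
... | ()
code-injective (node A B) leaf       e with ++-conicalʳ (code A) _ e
... | ()
code-injective (node A B) (node C D) e with <-cmp (size A) (size C)
... | tri< sA<sC _ _ = ⊥-elim (root-determined A B C D sA<sC e)
... | tri> _ _ sC<sA = ⊥-elim (root-determined C D A B sC<sA (sym e))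
... | tri≈ _ sA≡sC _
  with ++-cancel-length (code A) (code C) (trans (length-code A) (trans sA≡sC (sym (length-code C)))) e
... | eA , eB = cong₂ node (code-injective A C eA) (code-injective B D (proj₂ (∷-injective eB)))

Descent : Tree → List ℕ → Set
Descent s w = ∃[ α ] ∃[ s′ ] (rot α s ≡ just s′ × w ≤* code s′)

descend-left : ∀ {A B w₁ w₂} → Descent A w₁ → w₂ ≤* code B → Descent (node A B) (w₁ ++ size B ∷ w₂)
descend-left (α , A′ , e , w₁≤) w₂≤ = 𝟘 ∷ α , node A′ _ , rot-left α _ _ e , w₁≤ ++≤ (≤-refl ∷ w₂≤)

descend-right : ∀ {A B w₁ x w₂} → w₁ ≤* code A → x ≤ size B → Descent B w₂ → Descent (node A B) (w₁ ++ x ∷ w₂)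
descend-right w₁≤ x≤ (α , B′ , e , w₂≤) =
  𝟙 ∷ α , node _ B′ , rot-right α _ _ e , w₁≤ ++≤ (≤-trans x≤ (≤-reflexive (sym (rot-size α _ e))) ∷ w₂≤)

descend-root : ∀ {A B₁ B₂ w₁ x w₂} → w₁ ≤* code A → x ≤ size B₁ → w₂ ≤* code (node B₁ B₂) →
               Descent (node A (node B₁ B₂)) (w₁ ++ x ∷ w₂)
descend-root {A} {B₁} {B₂} w₁≤ x≤ w₂≤ =
  [] , _ , refl , subst (_ ≤*_) (sym (code-assocˡ A B₁ B₂)) (w₁≤ ++≤ (x≤ ∷ w₂≤))

-- When x < size B: rotate at the root if x ≤ size B₁; otherwise nestedness
-- of x ∷ w₂ forces w₂ ≠ code B, and we descend inside B.
descend-arm : ∀ A B {w₁ x w₂} → Nested (x ∷ w₂) → (w₂ ≢ code B → Descent B w₂) →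
              w₁ ≤* code A → x ≤ size B → x ≢ size B → w₂ ≤* code B → Descent (node A B) (w₁ ++ x ∷ w₂)
descend-arm A leaf         _        _     _   x≤ x≢ _   = ⊥-elim (x≢ (n≤0⇒n≡0 x≤))
descend-arm A (node B₁ B₂) {x = x} (bx , _) descB w₁≤ x≤ x≢ w₂≤ with x ≤? size B₁
... | yes x≤B₁ = descend-root w₁≤ x≤B₁ w₂≤
... | no  x≰B₁ = descend-right w₁≤ x≤ (descB λ w₂≡ →
        x≢ (≤-antisym x≤ (bounded-code-node B₁ B₂ x (subst (Bounded x) w₂≡ bx) (≰⇒> x≰B₁))))

descent : ∀ s w → Nested w → w ≤* code s → w ≢ code s → Descent s w
descent leaf       [] _  [] w≢ = ⊥-elim (w≢ refl)
descent (node A B) w  nw w≤ w≢ with split-at (code A) w≤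
... | w₁ , x , w₂ , refl , w₁≤ , x≤ , w₂≤ with x ≟ size B
...   | no x≢ = descend-arm A B (nested-suffix w₁ _ nw) (descent B w₂ (proj₂ (nested-suffix w₁ _ nw)) w₂≤)
                  w₁≤ x≤ x≢ w₂≤
...   | yes refl with ≡-dec _≟_ w₁ (code A)
...     | no w₁≢  = descend-left (descent A w₁ (nested-prefix w₁ _ nw) w₁≤ w₁≢) w₂≤
...     | yes refl = descend-right w₁≤ x≤ (descent B w₂ (proj₂ (nested-suffix w₁ _ nw)) w₂≤
                       (λ w₂≡ → w≢ (cong (λ z → code A ++ size B ∷ z) w₂≡)))

reach : ∀ r t → Acc _<_ (sum (code r)) → code t ≤* code r → ∃[ e ] act e r ≡ just t
reach r t (acc rs) t≤r with ≡-dec _≟_ (code t) (code r)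
... | yes t≡r rewrite code-injective t r t≡r = [] , refl
... | no  t≢r with descent r (code t) (code-nested t) t≤r t≢r
... | α , r′ , e , t≤r′ with reach r′ t (rs (sum-< (rot-decreasing α r e))) t≤r′
... | w , ew = α ∷ w , trans (cong (_>>= act w) e) ew

data Choice : List ℕ → List ℕ → List ℕ → Set where
  []    : Choice [] [] []
  left  : ∀ {x y z u v w} → x ≡ y → Choice u v w → Choice (x ∷ u) (y ∷ v) (z ∷ w)
  right : ∀ {x y z u v w} → x ≡ z → Choice u v w → Choice (x ∷ u) (y ∷ v) (z ∷ w)

choice-glb : ∀ {r a b w} → Choice r a b → w ≤* a → w ≤* b → w ≤* r
choice-glb []              []         []         = []
choice-glb (left  refl ch) (x≤ ∷ w≤a) (_  ∷ w≤b) = x≤ ∷ choice-glb ch w≤a w≤b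
choice-glb (right refl ch) (_  ∷ w≤a) (x≤ ∷ w≤b) = x≤ ∷ choice-glb ch w≤a w≤b

choice-sym : ∀ {r a b} → Choice r a b → Choice r b a
choice-sym []           = []
choice-sym (left  e ch) = right e (choice-sym ch)
choice-sym (right e ch) = left  e (choice-sym ch)

_++ᶜ_ : ∀ {u v w u′ v′ w′} → Choice u v w → Choice u′ v′ w′ → Choice (u ++ u′) (v ++ v′) (w ++ w′)
[]         ++ᶜ ch′ = ch′
left  e ch ++ᶜ ch′ = left  e (ch ++ᶜ ch′)
right e ch ++ᶜ ch′ = right e (ch ++ᶜ ch′)

choice-left : ∀ (u w : List ℕ) → length u ≡ length w → Choice u u w
choice-left []      []      _   = []
choice-left (x ∷ u) (z ∷ w) len = left refl (choice-left u w (cong pred len))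

choice-right : ∀ (u v : List ℕ) → length u ≡ length v → Choice u v u
choice-right u v len = choice-sym (choice-left u v len)

choice-refl : ∀ {u} → Choice u u u
choice-refl {u} = choice-left u u refl

choice-cast : ∀ {r r′ a a′ b b′} → r ≡ r′ → a ≡ a′ → b ≡ b′ → Choice r a b → Choice r′ a′ b′
choice-cast refl refl refl ch = ch

record Join (α β : Address) (s₁ s₂ : Tree) : Set where
  constructor joined
  field
    c d    : Word
    apex   : Tree
    square : (α ∷ c) ≈R (β ∷ d)
    via-c  : act c s₁ ≡ just apex
    via-d  : act d s₂ ≡ just apex
    choice : Choice (code apex) (code s₁) (code s₂)

join-sym : ∀ {α β s₁ s₂} → Join β α s₂ s₁ → Join α β s₁ s₂
join-sym (joined c d r sq ec ed ch) = joined d c r (≈-sym sq) ed ec (choice-sym ch)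

join-root : ∀ β A B C {s₂} → β ≢ [] → rot β (node A (node B C)) ≡ just s₂ → Join [] β (node (node A B) C) s₂
join-root [] _ _ _ β≢ _ = ⊥-elim (β≢ refl)
join-root (false ∷ β) A B C _ e with map-inv _ (rot β A) e
... | A′ , eA , refl =
  joined [ 𝟘 ∷ 𝟘 ∷ β ] [ [] ] (node (node A′ B) C) (≈-sym (≈-step [] [] (rel-0 [] β)))
    (cong (_>>= just) (rot-left (𝟘 ∷ β) (node A B) C (rot-left β A B eA))) refl
    (choice-cast (sym (code-assocˡ A′ B C)) (sym (code-assocˡ A B C)) refl
      (choice-right (code A′) (code A) (code-length A′ A (rot-size β A eA)) ++ᶜ left refl choice-refl))
join-root (true ∷ false ∷ β) A B C _ e with map-inv _ (Maybe.map _ (rot β B)) e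
... | _ , e′ , refl with map-inv _ (rot β B) e′
... | B′ , eB , refl =
  joined [ 𝟘 ∷ 𝟙 ∷ β ] [ [] ] (node (node A B′) C) (≈-sym (≈-step [] [] (rel-10 [] β)))
    (cong (_>>= just) (rot-left (𝟙 ∷ β) (node A B) C (rot-right β A B eB))) refl
    (choice-cast (sym (code-assocˡ A B′ C)) (sym (code-assocˡ A B C)) refl
      (choice-refl {code A} ++ᶜ
        left (rot-size β B eB) (choice-right (code B′) (code B) (code-length B′ B (rot-size β B eB)) ++ᶜ choice-refl)))
join-root (true ∷ true ∷ β) A B C _ e with map-inv _ (Maybe.map _ (rot β C)) e
... | _ , e′ , refl with map-inv _ (rot β C) e′
... | C′ , eC , refl =
  joined [ 𝟙 ∷ β ] [ [] ] (node (node A B) C′) (≈-sym (≈-step [] [] (rel-11 [] β)))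
    (cong (_>>= just) (rot-right β (node A B) C eC)) refl
    (choice-cast (sym (code-assocˡ A B C′)) (sym (code-assocˡ A B C)) refl
      (choice-refl {code A} ++ᶜ
        left refl (choice-refl {code B} ++ᶜ right refl (choice-right (code C′) (code C) (code-length C′ C (rot-size β C eC))))))
join-root (true ∷ []) A B (node C D) _ refl =
  joined [ [] ] ([] ∷ [ 𝟘 ] ∷ []) (node (node (node A B) C) D) (≈-step [] [] (rel-sq [])) refl refl
    (choice-cast (sym apex-code) (sym (code-assocˡ A B (node C D))) (sym s₂-code)
      (choice-refl {code A} ++ᶜ left refl (choice-refl {code B} ++ᶜ right refl choice-refl)))
  where
  apex-code : code (node (node (node A B) C) D) ≡ code A ++ size B ∷ code B ++ size C ∷ code C ++ size D ∷ code D
  apex-code = trans (code-assocˡ (node A B) C D) (++-assoc (code A) (size B ∷ code B) _)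
  s₂-code : code (node A (node (node B C) D)) ≡ code A ++ size (node (node B C) D) ∷ code B ++ size C ∷ code C ++ size D ∷ code D
  s₂-code = cong (λ z → code A ++ size (node (node B C) D) ∷ z) (code-assocˡ B C D)

join-orth : ∀ α β A B {s₁ s₂} → rot (𝟘 ∷ α) (node A B) ≡ just s₁ → rot (𝟙 ∷ β) (node A B) ≡ just s₂ →
            Join (𝟘 ∷ α) (𝟙 ∷ β) s₁ s₂
join-orth α β A B e₁ e₂ with map-inv _ (rot α A) e₁ | map-inv _ (rot β B) e₂
... | A′ , eA , refl | B′ , eB , refl =
  joined [ 𝟙 ∷ β ] [ 𝟘 ∷ α ] (node A′ B′) (≈-step [] [] (rel-comm (inj₁ ([] , α , β , refl , refl))))
    (cong (_>>= just) (rot-right β A′ B eB)) (cong (_>>= just) (rot-left α A B′ eA))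
    (choice-left (code A′) (code A) (code-length A′ A (rot-size α A eA)) ++ᶜ
      right refl (choice-right (code B′) (code B) (code-length B′ B (rot-size β B eB))))

join-left : ∀ {α β A₁ A₂} B → Join α β A₁ A₂ → Join (𝟘 ∷ α) (𝟘 ∷ β) (node A₁ B) (node A₂ B)
join-left {A₁ = A₁} {A₂} B (joined c d r sq ec ed ch) =
  joined (map (𝟘 ∷_) c) (map (𝟘 ∷_) d) (node r B) (≈-shift 𝟘 sq)
    (trans (act-left c A₁ B) (cong (Maybe.map _) ec)) (trans (act-left d A₂ B) (cong (Maybe.map _) ed))
    (ch ++ᶜ choice-refl)

join-right : ∀ {α β B₁ B₂} A → Join α β B₁ B₂ → Join (𝟙 ∷ α) (𝟙 ∷ β) (node A B₁) (node A B₂)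
join-right {B₁ = B₁} {B₂} A (joined c d r sq ec ed ch) =
  joined (map (𝟙 ∷_) c) (map (𝟙 ∷_) d) (node A r) (≈-shift 𝟙 sq)
    (trans (act-right c A B₁) (cong (Maybe.map _) ec)) (trans (act-right d A B₂) (cong (Maybe.map _) ed))
    (choice-refl {code A} ++ᶜ left (act-size c B₁ ec) ch)

join : ∀ α β s {s₁ s₂} → α ≢ β → rot α s ≡ just s₁ → rot β s ≡ just s₂ → Join α β s₁ s₂
join []          []          _ α≢β _ _ = ⊥-elim (α≢β refl)
join []          (b ∷ β)     (node A (node B C)) _ refl e₂ = join-root (b ∷ β) A B C (λ ()) e₂
join (a ∷ α)     []          (node A (node B C)) _ e₁ refl = join-sym (join-root (a ∷ α) A B C (λ ()) e₁)
join (false ∷ α) (true ∷ β)  (node A B) _ e₁ e₂ = join-orth α β A B e₁ e₂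
join (true ∷ α)  (false ∷ β) (node A B) _ e₁ e₂ = join-sym (join-orth β α A B e₂ e₁)
join (false ∷ α) (false ∷ β) (node A B) α≢β e₁ e₂ with map-inv _ (rot α A) e₁ | map-inv _ (rot β A) e₂
... | A₁ , eA₁ , refl | A₂ , eA₂ , refl = join-left B (join α β A (α≢β ∘ cong (𝟘 ∷_)) eA₁ eA₂)
join (true ∷ α)  (true ∷ β)  (node A B) α≢β e₁ e₂ with map-inv _ (rot α B) e₁ | map-inv _ (rot β B) e₂
... | B₁ , eB₁ , refl | B₂ , eB₂ , refl = join-right A (join α β B (α≢β ∘ cong (𝟙 ∷_)) eB₁ eB₂)

-- If their
-- first letters a ≠ b differ, join them (a c ≈ b d, apex r); t lies below
-- both rotations of s, hence below r, so some e takes r to t; by induction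
-- p ≈ c e and q ≈ d e, whence a p ≈ a c e ≈ b d e ≈ b q.
coherence : ∀ s t p q → Acc _<_ (sum (code s)) → act p s ≡ just t → act q s ≡ just t → p ≈R q
coherence s t []      []      _ _    _    = ≈-refl
coherence s t []      (b ∷ q) _ refl eq   = ⊥-elim (<-irrefl refl (act-strict b q s eq))
coherence s t (a ∷ p) []      _ ep   refl = ⊥-elim (<-irrefl refl (act-strict a p s ep))
coherence s t (a ∷ p) (b ∷ q) (acc rs) ep eq
  with >>=-inv (rot a s) (act p) ep | >>=-inv (rot b s) (act q) eq
... | s₁ , ea , ep′ | s₂ , eb , eq′ with ≡-dec Bool._≟_ a b
...   | yes refl with trans (sym ea) eb
...     | refl = ≈-cons a (coherence s₁ t p q (rs (sum-< (rot-decreasing a s ea))) ep′ eq′)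
coherence s t (a ∷ p) (b ∷ q) (acc rs) ep eq | s₁ , ea , ep′ | s₂ , eb , eq′ | no a≢b
  with join a b s a≢b ea eb
... | joined c d r square ec ed ch
  with reach r t (<-wellFounded _) (choice-glb ch (act-decreasing p s₁ ep′) (act-decreasing q s₂ eq′))
... | e , ee = ≈-trans (≈-cons a p≈ce) (≈-trans (≈-app e square) (≈-sym (≈-cons b q≈de)))
  where
  p≈ce : p ≈R (c ++ e)
  p≈ce = coherence s₁ t p (c ++ e) (rs (sum-< (rot-decreasing a s ea))) ep′ (act-then c e s₁ ec ee)
  q≈de : q ≈R (d ++ e)
  q≈de = coherence s₂ t q (d ++ e) (rs (sum-< (rot-decreasing b s eb))) eq′ (act-then d e s₂ ed ee)

-- If uw ≈ vw then u and v act on some tree with the same result: take a tree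
-- on which uw (hence vw) acts, and cancel w by injectivity of its action.
common-image : ∀ u v w → (u ++ w) ≈R (v ++ w) → ∃[ s ] ∃[ x ] (act u s ≡ just x × act v s ≡ just x)
common-image u v w uw≈vw with act-deep (u ++ w) (full (cost (u ++ w))) (Deep-full _)
... | y , ey with act-++-inv u w _ ey | act-++-inv v w _ (trans (sym (≈-sound uw≈vw _)) ey)
... | x , eu , ew | x′ , ev , ew′ with act-injective w x x′ ew ew′
... | refl = full (cost (u ++ w)) , x , eu , ev

proposition3p7 : RightCancellative
proposition3p7 u v w uw≈vw with common-image u v w uw≈vw
... | s , x , eu , ev = coherence s x u v (<-wellFounded _) eu ev
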